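{- Let $\otimes$ be a merge on $\mathbb{S}$. Then $(\mathcal{R},\eta^{\mathcal{R}},(\cdot)^{\mathcal{R}})$ is a Kleisli triple over the category of sets, and hence a monad.
   Context: $\mathbb{S}$ is the set of states: finite sets $s$ of triples $\langle P,\vec m,n\rangle$ ($P$ a $(k+1)$-ary primitive recursive predicate symbol, $\vec m\in\mathbb{N}^k$, $n\in\mathbb{N}$) with $P(\vec m,n)$ true in the standard model and at most one $n$ for each $(P,\vec m)$; $\bot=\emptyset$. For a set $X$, $\mathcal{S}X$ is the set of functions $\mathbb{S}\to X$; for $g:X\to\mathcal{S}Y$ put $g^{*}:\mathcal{S}X\to\mathcal{S}Y$, $g^{*}(\alpha)=\lambda s.\,g(\alpha(s))(s)$. A merge is a map $\otimes:\mathbb{S}\times\mathbb{S}\to\mathbb{S}$ such that $(\mathbb{S},\otimes,\bot)$ is a monoid, $s_1\otimes s_2=\bot$ implies $s_1=s_2=\bot$, and $s_1\otimes s_2\subseteq s_1\cup s_2$. Its pointwise lifting is $\otimes^{\mathcal{S}}$ on $\mathcal{S}\mathbb{S}$: $(r\otimes^{\mathcal{S}}r')(s)=r(s)\otimes r'(s)$. Define $\mathcal{R}X=\mathcal{S}X\times\mathcal{S}\mathbb{S}$, $\eta^{\mathcal{R}}_X(x)=(\lambda\_.x,\lambda\_.\bot)$, and for $f:X\to\mathcal{R}Y$ with components $f_1=\pi_1\circ f:X\to\mathcal{S}Y$, $f_2=\pi_2\circ f:X\to\mathcal{S}\mathbb{S}$, put $f^{\mathcal{R}}(\alpha,r)=(f_1^{*}(\alpha),\,r\otimes^{\mathcal{S}}f_2^{*}(\alpha))$.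 A Kleisli triple $(T,\eta,(\cdot)^\dagger)$ over sets consists of an assignment $X\mapsto TX$, maps $\eta_X:X\to TX$, and for each $f:X\to TY$ a map $f^\dagger:TX\to TY$ with $f^\dagger\circ\eta_X=f$, $\eta_X^\dagger=\mathrm{id}_{TX}$, and $g^\dagger\circ f^\dagger=(g^\dagger\circ f)^\dagger$ for $g:Y\to TZ$. -}

module Defs where

open import Level using (0ℓ)
open import Data.Nat using (ℕ; zero; suc; _<_)
open import Data.Fin using (Fin)
open import Data.Vec using (Vec; []; _∷_; _∷ʳ_; lookup)
open import Data.List using (List; [])
open import Data.List.Membership.Propositional using (_∈_)
open import Data.List.Relation.Unary.All using (All)
open import Data.Product using (Σ; _×_; _,_; proj₁; proj₂)
open import Data.Sum using (_⊎_)
open import Function using (_∘_)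
open import Function.Bundles using (_⇔_)
open import Relation.Binary.PropositionalEquality using (_≡_)
open import Algebra.Structures using (IsMonoid)

data PR : ℕ → Set where
  zeroF : ∀ {n} → PR n
  succF : PR 1
  projF : ∀ {n} → Fin n → PR n
  compF : ∀ {m n} → PR m → Vec (PR n) m → PR n
  recF  : ∀ {n} → PR n → PR (suc (suc n)) → PR (suc n)

mutual
  eval : ∀ {n} → PR n → Vec ℕ n → ℕ
  eval zeroF xs = 0
  eval succF (x ∷ []) = suc x
  eval (projF i) xs = lookup xs i
  eval (compF f gs) xs = eval f (evalVec gs xs)
  eval (recF g h) (y ∷ xs) = evalRec g h y xs

  evalVec : ∀ {m n} → Vec (PR n) m → Vec ℕ n → Vec ℕ m
  evalVec [] xs = []
  evalVec (g ∷ gs) xs = eval g xs ∷ evalVec gs xs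

  evalRec : ∀ {n} → PR n → PR (suc (suc n)) → ℕ → Vec ℕ n → ℕ
  evalRec g h zero xs = eval g xs
  evalRec g h (suc y) xs = eval h (y ∷ evalRec g h y xs ∷ xs)

-- A (k+1)-ary primitive recursive predicate symbol is the code of its
-- characteristic function; P(xs) is true in the standard model iff the
-- characteristic function is nonzero there.
PredSym : ℕ → Set
PredSym k = PR (suc k)

TrueIn : ∀ {k} → PredSym k → Vec ℕ (suc k) → Set
TrueIn P xs = 0 < eval P xs

record Triple : Set where
  constructor ⟨_,_,_⟩
  field
    {arity} : ℕ
    pred    : PredSym arity
    args    : Vec ℕ arity
    val     : ℕ
open Triple public

Key : Set
Key = Σ ℕ (λ k → PredSym k × Vec ℕ k)

key : Triple → Key
key t = arity t , pred t , args t

ValidTriple : Triple → Set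
ValidTriple t = TrueIn (pred t) (args t ∷ʳ val t)

-- A state: a finite set (given by a list enumerating it) of true triples,
-- with at most one n for each (P, m⃗).
record State : Set where
  constructor mkState
  field
    elems      : List Triple
    valid      : All ValidTriple elems
    functional : ∀ {t t′} → t ∈ elems → t′ ∈ elems → key t ≡ key t′ → val t ≡ val t′
open State public

_∈ˢ_ : Triple → State → Set
t ∈ˢ s = t ∈ elems s

-- equality of states is equality as finite sets
_≈ˢ_ : State → State → Set
s ≈ˢ s′ = ∀ t → (t ∈ˢ s) ⇔ (t ∈ˢ s′)

_⊆ˢ_ : State → State → Set
s ⊆ˢ s′ = ∀ t → t ∈ˢ s → t ∈ˢ s′

_∈∪_,_ : Triple → State → State → Set
t ∈∪ s₁ , s₂ = (t ∈ˢ s₁) ⊎ (t ∈ˢ s₂)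

⊥ˢ : State
⊥ˢ = mkState [] All.[] (λ ())

record IsMerge (_⊗_ : State → State → State) : Set where
  field
    -- ⊗ is a well-defined map on 𝕊 × 𝕊 (respects set equality)
    ⊗-cong   : ∀ {s₁ s₁′ s₂ s₂′} → s₁ ≈ˢ s₁′ → s₂ ≈ˢ s₂′ → (s₁ ⊗ s₂) ≈ˢ (s₁′ ⊗ s₂′)
    isMonoid : IsMonoid _≈ˢ_ _⊗_ ⊥ˢ
    zero-sum : ∀ s₁ s₂ → (s₁ ⊗ s₂) ≈ˢ ⊥ˢ → (s₁ ≈ˢ ⊥ˢ) × (s₂ ≈ˢ ⊥ˢ)
    ⊆-∪      : ∀ s₁ s₂ t → t ∈ˢ (s₁ ⊗ s₂) → t ∈∪ s₁ , s₂

𝒮 : Set → Set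
𝒮 X = State → X

_* : ∀ {X Y : Set} → (X → 𝒮 Y) → 𝒮 X → 𝒮 Y
(g *) α = λ s → g (α s) s

module RMonad (_⊗_ : State → State → State) where

  _⊗𝒮_ : 𝒮 State → 𝒮 State → 𝒮 State
  (r ⊗𝒮 r′) s = r s ⊗ r′ s

  ℛ : Set → Set
  ℛ X = 𝒮 X × 𝒮 State

  ηℛ : ∀ {X : Set} → X → ℛ X
  ηℛ x = (λ _ → x) , (λ _ → ⊥ˢ)

  extℛ : ∀ {X Y : Set} → (X → ℛ Y) → ℛ X → ℛ Y
  extℛ f (α , r) = ((proj₁ ∘ f) *) α , (r ⊗𝒮 ((proj₂ ∘ f) *) α)

  _≈ℛ_ : ∀ {X : Set} → ℛ X → ℛ X → Set
  (α , r) ≈ℛ (α′ , r′) = (∀ s → α s ≡ α′ s) × (∀ s → r s ≈ˢ r′ s)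

record IsKleisliTriple (T : Set → Set)
                       (_≈_ : ∀ {X : Set} → T X → T X → Set)
                       (η : ∀ {X : Set} → X → T X)
                       (_† : ∀ {X Y : Set} → (X → T Y) → T X → T Y) : Set₁ where
  field
    †-η   : ∀ {X Y : Set} (f : X → T Y) (x : X) → (f †) (η x) ≈ f x
    η-†   : ∀ {X : Set} (a : T X) → ((η {X}) †) a ≈ a
    †-∘   : ∀ {X Y Z : Set} (f : X → T Y) (g : Y → T Z) (a : T X)
            → (g †) ((f †) a) ≈ (((g †) ∘ f) †) a

module Submission where

-- ℛX = 𝒮X × 𝒮𝕊 combines two standard monads.  Its first component is the
-- reader monad 𝒮 = (𝕊 → _), whose Kleisli laws hold definitionally.  Its
-- second component accumulates states with ⊗, like a writer monad, but over
-- the pointwise-lifted monoid (𝒮𝕊, ⊗𝒮, λ _ → ⊥); the extension of f first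
-- reads the input state and then appends f's output r.

open import Defs
open import Data.Product using (_,_; proj₁; proj₂)
open import Function using (_∘_)
open import Relation.Binary.PropositionalEquality using (_≡_; refl)
open import Algebra.Structures using (IsMonoid)
import Algebra.Construct.Pointwise as Pointwise

*-unitˡ : ∀ {X Y : Set} (g : X → 𝒮 Y) (x : X) (s : State) → (g *) (λ _ → x) s ≡ g x s
*-unitˡ g x s = refl

*-unitʳ : ∀ {X : Set} (α : 𝒮 X) (s : State) → ((λ x _ → x) *) α s ≡ α s
*-unitʳ α s = refl

*-assoc : ∀ {X Y Z : Set} (f : X → 𝒮 Y) (g : Y → 𝒮 Z) (α : 𝒮 X) (s : State)
          → (g *) ((f *) α) s ≡ (((g *) ∘ f) *) α s
*-assoc f g α s = refl

module KleisliTriple (_⊗_ : State → State → State) (⊗-isMonoid : IsMonoid _≈ˢ_ _⊗_ ⊥ˢ) where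

  open RMonad _⊗_

  _≈𝒮_ : 𝒮 State → 𝒮 State → Set
  r ≈𝒮 r′ = ∀ s → r s ≈ˢ r′ s

  ⊥𝒮 : 𝒮 State
  ⊥𝒮 _ = ⊥ˢ

  ⊗𝒮-isMonoid : IsMonoid _≈𝒮_ _⊗𝒮_ ⊥𝒮
  ⊗𝒮-isMonoid = Pointwise.isMonoid State ⊗-isMonoid

  open IsMonoid ⊗𝒮-isMonoid using (identityˡ; identityʳ; assoc)

  out : ∀ {X Y : Set} → (X → ℛ Y) → X → 𝒮 Y
  out f = proj₁ ∘ f

  acc : ∀ {X Y : Set} → (X → ℛ Y) → X → 𝒮 State
  acc f = proj₂ ∘ f

  ext-unitˡ : ∀ {X Y : Set} (f : X → ℛ Y) (x : X) → extℛ f (ηℛ x) ≈ℛ f x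
  ext-unitˡ f x = *-unitˡ (out f) x , identityˡ (acc f x)

  ext-unitʳ : ∀ {X : Set} (a : ℛ X) → extℛ ηℛ a ≈ℛ a
  ext-unitʳ (α , r) = *-unitʳ α , identityʳ r

  -- g^ℛ ∘ f^ℛ = (g^ℛ ∘ f)^ℛ : the outputs are r, then f's, then g's, and
  -- bracketing them differently is associativity of ⊗𝒮.  On the right, the
  -- accumulated output of g^ℛ ∘ f at x is acc f x ⊗𝒮 (acc g *) (out f x), and
  -- reading it at the state of α is definitionally a ⊗𝒮-product again.
  ext-assoc : ∀ {X Y Z : Set} (f : X → ℛ Y) (g : Y → ℛ Z) (a : ℛ X)
              → extℛ g (extℛ f a) ≈ℛ extℛ (extℛ g ∘ f) a
  ext-assoc f g (α , r) = *-assoc (out f) (out g) α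
                        , assoc r ((acc f *) α) ((acc g *) ((out f *) α))

  isKleisliTriple : IsKleisliTriple ℛ _≈ℛ_ ηℛ extℛ
  isKleisliTriple = record { †-η = ext-unitˡ ; η-† = ext-unitʳ ; †-∘ = ext-assoc }

theorem5p7 : (_⊗_ : State → State → State) → IsMerge _⊗_
    → IsKleisliTriple (RMonad.ℛ _⊗_) (RMonad._≈ℛ_ _⊗_) (RMonad.ηℛ _⊗_) (RMonad.extℛ _⊗_)
theorem5p7 _⊗_ merge = KleisliTriple.isKleisliTriple _⊗_ (IsMerge.isMonoid merge)
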